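{- Let $x$ be an element of $B_n/C_n$ at which $\phi$ is defined, and write $x$ as its Lyndon rearrangement $a_1\cdots a_n$. Suppose $\phi(x)$ is represented by $a'_1\cdots a'_n$, where $a_i=1$, $a'_i=0$, and $a'_j=a_j$ for all $j\ne i$. Then the Lyndon rearrangement of $a'_1\cdots a'_n$ equals $a'_j\cdots a'_n a'_1\cdots a'_{j-1}$ for some $j$ with $j=1$ or $j>i$. In words, the Lyndon expression of $\phi(x)$ either shifts the letter $a'_i$ to the right or leaves its position unchanged.
   Context: $B_n/C_n$: binary words of length $n$ up to cyclic rotation. Lyndon rearrangement: order letters by $1\prec 0$; the Lyndon rearrangement of a word is its lexicographically smallest cyclic rotation. Parenthesization: regard the word cyclically; repeatedly take a 0 immediately followed cyclically (among not yet matched letters) by a 1, match them as a parenthesization pair, and remove them, until no such 0 remains. $\phi$ on the upper half: for $x$ with more 1's than 0's, $\phi(x)$ is obtained from the Lyndon rearrangement of $x$ by changing its rightmost unmatched 1 into a 0. If there were at least two unmatched 1's, the changed letter forms a newly created pair with a previously unmatched 1. $\phi$ on the lower half: starting from $y_0$ with more 1's than 0's not in the image of $\phi$, apply $\phi$ until the first element $y_s$ with at least as many 0's as 1's. Let $P_1,\dots,P_t$ be the created pairs, in order. Then $\phi(y_s),\phi(y_{s+1}),\dots$ successively change the letter that is still a 1 in $P_t,P_{t-1},\dots$ into a 0, until all created pairs are undone. This is well defined. -}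

module Defs where

open import Data.Bool using (Bool; true; false; if_then_else_; not; _∨_)
open import Data.Nat using (ℕ; zero; suc; _+_; _∸_; _<_; _≤_; _≤ᵇ_; _≡ᵇ_)
open import Data.List using (List; []; _∷_; _++_; drop; take; length; map; foldr; upTo; zip)
open import Data.Maybe using (Maybe; just; nothing)
open import Data.Product using (Σ; _×_; _,_; proj₁; proj₂)
open import Data.Sum using (_⊎_)
open import Data.List.Membership.Propositional using (_∈_)
open import Relation.Binary.PropositionalEquality using (_≡_)
open import Relation.Nullary using (¬_)

-- Binary words.  Convention: true = letter 1, false = letter 0.
-- Positions are 0-based (paper position k corresponds to index k-1).

Word : Set
Word = List Bool

-- letter at position q (default 0 outside the word; never used there)
at : Word → ℕ → Bool
at []      _       = false
at (b ∷ _) zero    = b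
at (_ ∷ w) (suc q) = at w q

-- change the letter at position q into a 0
flip : ℕ → Word → Word
flip _       []      = []
flip zero    (_ ∷ w) = false ∷ w
flip (suc q) (b ∷ w) = b ∷ flip q w

count : Bool → Word → ℕ
count c []      = 0
count c (b ∷ w) = (if (if b then c else not c) then 1 else 0) + count c w

ones zeros : Word → ℕ
ones  = count true
zeros = count false

Upper : Word → Set
Upper w = zeros w < ones w

-- Cyclic rotations.  rotate j w = w_{j+1} ... w_n w_1 ... w_j
-- (paper: a_{j+1} ... a_n a_1 ... a_j with 1-based letters).

rotate : ℕ → Word → Word
rotate k w = drop k w ++ take k w

-- v represents the same element of B_n/C_n as u (v is a rotation of u)
Rot : Word → Word → Set
Rot u v = Σ ℕ λ k → rotate k u ≡ v

-- Lexicographic order with 1 ≺ 0 ; Lyndon rearrangement = the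
-- lexicographically smallest cyclic rotation.

lexLeq : Word → Word → Bool
lexLeq []          _           = true
lexLeq (_ ∷ _)     []          = false
lexLeq (true ∷ u)  (true ∷ v)  = lexLeq u v
lexLeq (false ∷ u) (false ∷ v) = lexLeq u v
lexLeq (true ∷ _)  (false ∷ _) = true
lexLeq (false ∷ _) (true ∷ _)  = false

minL : Word → Word → Word
minL a b = if lexLeq a b then a else b

lyndon : Word → Word
lyndon w = foldr minL w (map (λ k → rotate k w) (upTo (length w)))

-- The state is the increasing list of
-- positions of not yet matched letters; one step matches the first
-- unmatched 0 that is cyclically immediately followed (among unmatched
-- letters) by a 1.  Pairs are recorded as (position of 0 , position of 1).

filterB : {A : Set} → (A → Bool) → List A → List A
filterB p []      = []
filterB p (x ∷ xs) = if p x then x ∷ filterB p xs else filterB p xs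

lastM : {A : Set} → List A → Maybe A
lastM []           = nothing
lastM (x ∷ [])     = just x
lastM (_ ∷ y ∷ ys) = lastM (y ∷ ys)

cyclicPairs : List ℕ → List (ℕ × ℕ)
cyclicPairs rem = zip rem (drop 1 rem ++ take 1 rem)

firstMatch : Word → List (ℕ × ℕ) → Maybe (ℕ × ℕ)
firstMatch w [] = nothing
firstMatch w ((a , b) ∷ ps) =
  if (not (at w a)) Data.Bool.∧ at w b then just (a , b) else firstMatch w ps

parenLoop : ℕ → Word → List (ℕ × ℕ) → List ℕ → List (ℕ × ℕ) × List ℕ
parenLoop zero    w acc rem = acc , rem
parenLoop (suc f) w acc rem with firstMatch w (cyclicPairs rem)
... | nothing       = acc , rem
... | just (a , b)  =
  parenLoop f w ((a , b) ∷ acc) (filterB (λ q → not ((q ≡ᵇ a) ∨ (q ≡ᵇ b))) rem)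

paren : Word → List (ℕ × ℕ) × List ℕ
paren w = parenLoop (length w) w [] (upTo (length w))

pairs : Word → List (ℕ × ℕ)
pairs w = proj₁ (paren w)

unmatched1s : Word → List ℕ
unmatched1s w = filterB (at w) (proj₂ (paren w))

rightmostUnmatched1 : Word → Maybe ℕ
rightmostUnmatched1 w = lastM (unmatched1s w)

PhiUp : Word → Word → Set
PhiUp x y = Upper x × Σ ℕ λ i →
  rightmostUnmatched1 (lyndon x) ≡ just i × y ≡ flip i (lyndon x)

-- y0 lies in the image of φ.  (Elements with more 1's than 0's can only be
-- images of upper-half elements, since φ on the lower half stays there.)
InImageUp : Word → Set
InImageUp y0 = Σ Word λ x → Σ Word λ y → PhiUp x y × Rot y y0

-- A state is a representative W of the
-- current element together with a stack of positions (in W) of the letters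
-- that are still 1 in the created pairs P_t, P_{t-1}, ..., P_1 (head = P_t).

-- position q of W becomes position shiftPos n r q of rotate r W
shiftPos : ℕ → ℕ → ℕ → ℕ
shiftPos n r q = if r ≤ᵇ q then q ∸ r else (q + n) ∸ r

data UpStep : Word → List ℕ → Word → List ℕ → Set where
  created : ∀ {W S} (r i p : ℕ) →
    Upper W → r < length W → rotate r W ≡ lyndon W →
    rightmostUnmatched1 (lyndon W) ≡ just i →
    2 ≤ length (unmatched1s (lyndon W)) →
    (i , p) ∈ pairs (flip i (lyndon W)) →
    UpStep W S (flip i (lyndon W)) (p ∷ map (shiftPos (length W) r) S)
  single : ∀ {W S} (r i : ℕ) →
    Upper W → r < length W → rotate r W ≡ lyndon W →
    rightmostUnmatched1 (lyndon W) ≡ just i →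
    length (unmatched1s (lyndon W)) < 2 →
    UpStep W S (flip i (lyndon W)) (map (shiftPos (length W) r) S)

data UpRun : Word → List ℕ → Word → List ℕ → Set where
  done : ∀ {W S} → UpRun W S W S
  step : ∀ {W S W′ S′ W″ S″} → UpStep W S W′ S′ → UpRun W′ S′ W″ S″ →
         UpRun W S W″ S″

-- successive undoing of created pairs, P_t first
data DownRun : Word → List ℕ → Word → List ℕ → Set where
  done : ∀ {W S} → DownRun W S W S
  step : ∀ {W p S W″ S″} → DownRun (flip p W) S W″ S″ →
         DownRun W (p ∷ S) W″ S″

PhiDown : Word → Word → Set
PhiDown x y =
  Σ Word λ y0 → Upper y0 × ¬ InImageUp y0 ×
  Σ Word λ Ws → Σ (List ℕ) λ Ss →
    UpRun y0 [] Ws Ss × ¬ Upper Ws ×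
  Σ Word λ W → Σ ℕ λ p → Σ (List ℕ) λ S →
    DownRun Ws Ss W (p ∷ S) × Rot W x × y ≡ flip p W

Phi : Word → Word → Set
Phi x y = PhiUp x y ⊎ PhiDown x y

-- Let L be the Lyndon rearrangement of x and L' = flip i L, and suppose the
-- least rotation of L' is its rotation by k with 0 < k ≤ i.  By minimality
-- of L, L ≼ rotate k L, and the 1 at position i of L sits at the earlier
-- position i ∸ k of rotate k L.  Changing a 1 into a 0 at a later position of
-- the smaller word and at an earlier position of the larger one keeps them
-- ordered: either they already differ before the earlier position, or the
-- larger word is lowered first.  Hence L' ≼ rotate k L', so rotate k L' = L'
-- and the rotation by 0 is least as well.
module Submission where

open import Defs
open import Data.Bool using (true; false)
open import Data.Nat using (ℕ; zero; suc; _+_; _∸_; _<_; _≤_; z≤n; s≤s)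
open import Data.Nat.Properties
  using (≤-trans; <⇒≤; ≰⇒>; ≮⇒≥; _≤?_; _<?_; m≤m+n; +-monoʳ-<; +-cancelʳ-<;
         +-comm; m+[n∸m]≡n; ∸-monoˡ-<; ∸-monoʳ-<)
open import Data.List using (List; []; _∷_; _++_; length; take; drop; foldr; map; upTo)
open import Data.List.Properties
  using (++-assoc; ++-identityʳ; length-++; length-++-comm; take++drop≡id; length-drop)
open import Data.List.Membership.Propositional using (_∈_)
open import Data.List.Membership.Propositional.Properties using (∈-map⁺; ∈-map⁻; ∈-upTo⁺; ∈-upTo⁻)
open import Data.List.Relation.Unary.Any using (here; there)
open import Data.Product using (Σ; _×_; _,_)
open import Data.Sum using (_⊎_; inj₁; inj₂)
open import Relation.Binary.PropositionalEquality
open import Relation.Nullary using (yes; no)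

_≼_ : Word → Word → Set
u ≼ v = lexLeq u v ≡ true

lexLeq-refl : ∀ u → u ≼ u
lexLeq-refl []          = refl
lexLeq-refl (true ∷ u)  = lexLeq-refl u
lexLeq-refl (false ∷ u) = lexLeq-refl u

lexLeq-total : ∀ u v → lexLeq u v ≡ false → v ≼ u
lexLeq-total []          v           ()
lexLeq-total (_ ∷ u)     []          _  = refl
lexLeq-total (true ∷ u)  (true ∷ v)  h  = lexLeq-total u v h
lexLeq-total (true ∷ u)  (false ∷ v) ()
lexLeq-total (false ∷ u) (true ∷ v)  _  = refl
lexLeq-total (false ∷ u) (false ∷ v) h  = lexLeq-total u v h

lexLeq-trans : ∀ u v w → u ≼ v → v ≼ w → u ≼ w
lexLeq-trans []          _           _           _  _  = refl
lexLeq-trans (_ ∷ u)     []          _           () _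
lexLeq-trans (_ ∷ u)     (_ ∷ v)     []          _  ()
lexLeq-trans (true ∷ u)  (true ∷ v)  (true ∷ w)  h₁ h₂ = lexLeq-trans u v w h₁ h₂
lexLeq-trans (true ∷ u)  (true ∷ v)  (false ∷ w) _  _  = refl
lexLeq-trans (true ∷ u)  (false ∷ v) (true ∷ w)  _  ()
lexLeq-trans (true ∷ u)  (false ∷ v) (false ∷ w) _  _  = refl
lexLeq-trans (false ∷ u) (true ∷ v)  _           () _
lexLeq-trans (false ∷ u) (false ∷ v) (true ∷ w)  _  ()
lexLeq-trans (false ∷ u) (false ∷ v) (false ∷ w) h₁ h₂ = lexLeq-trans u v w h₁ h₂

lexLeq-antisym : ∀ u v → u ≼ v → v ≼ u → u ≡ v
lexLeq-antisym []          []          _  _  = refl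
lexLeq-antisym []          (_ ∷ v)     _  ()
lexLeq-antisym (_ ∷ u)     []          () _
lexLeq-antisym (true ∷ u)  (true ∷ v)  h₁ h₂ = cong (true ∷_) (lexLeq-antisym u v h₁ h₂)
lexLeq-antisym (true ∷ u)  (false ∷ v) _  ()
lexLeq-antisym (false ∷ u) (true ∷ v)  () _
lexLeq-antisym (false ∷ u) (false ∷ v) h₁ h₂ = cong (false ∷_) (lexLeq-antisym u v h₁ h₂)

minL-≼ˡ : ∀ u v → minL u v ≼ u
minL-≼ˡ u v with lexLeq u v in eq
... | true  = lexLeq-refl u
... | false = lexLeq-total u v eq

minL-≼ʳ : ∀ u v → minL u v ≼ v
minL-≼ʳ u v with lexLeq u v in eq
... | true  = eq
... | false = lexLeq-refl v

minL-selective : ∀ u v → minL u v ≡ u ⊎ minL u v ≡ v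
minL-selective u v with lexLeq u v
... | true  = inj₁ refl
... | false = inj₂ refl

foldr-minL-≼ : ∀ z us v → v ≡ z ⊎ v ∈ us → foldr minL z us ≼ v
foldr-minL-≼ z []       v (inj₁ refl)        = lexLeq-refl z
foldr-minL-≼ z (u ∷ us) v (inj₂ (here refl)) = minL-≼ˡ u (foldr minL z us)
foldr-minL-≼ z (u ∷ us) v (inj₁ v≡z)         =
  lexLeq-trans (minL u (foldr minL z us)) (foldr minL z us) v (minL-≼ʳ u (foldr minL z us)) (foldr-minL-≼ z us v (inj₁ v≡z))
foldr-minL-≼ z (u ∷ us) v (inj₂ (there v∈))  =
  lexLeq-trans (minL u (foldr minL z us)) (foldr minL z us) v (minL-≼ʳ u (foldr minL z us)) (foldr-minL-≼ z us v (inj₂ v∈))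

foldr-minL-∈ : ∀ z us → foldr minL z us ≡ z ⊎ foldr minL z us ∈ us
foldr-minL-∈ z []       = inj₁ refl
foldr-minL-∈ z (u ∷ us) with minL-selective u (foldr minL z us)
... | inj₁ eq = inj₂ (here eq)
... | inj₂ eq with foldr-minL-∈ z us
...   | inj₁ eq′ = inj₁ (trans eq eq′)
...   | inj₂ m∈  = inj₂ (there (subst (_∈ us) (sym eq) m∈))

rotations : Word → List Word
rotations w = map (λ k → rotate k w) (upTo (length w))

lyndon-≼-self : ∀ w → lyndon w ≼ w
lyndon-≼-self w = foldr-minL-≼ w (rotations w) w (inj₁ refl)

lyndon-≼-rotate : ∀ w k → k < length w → lyndon w ≼ rotate k w
lyndon-≼-rotate w k k<n =
  foldr-minL-≼ w (rotations w) (rotate k w) (inj₂ (∈-map⁺ (λ k → rotate k w) (∈-upTo⁺ k<n)))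

lyndon-isRotation : ∀ w → 0 < length w → Σ ℕ λ k → k < length w × lyndon w ≡ rotate k w
lyndon-isRotation w 0<n with foldr-minL-∈ w (rotations w)
... | inj₁ eq = 0 , 0<n , trans eq (sym (++-identityʳ w))
... | inj₂ m∈ with ∈-map⁻ (λ k → rotate k w) m∈
...   | k , k∈ , eq = k , ∈-upTo⁻ k∈ , eq

module _ {A : Set} where

  drop-++-length : ∀ (a b : List A) t → drop (length a + t) (a ++ b) ≡ drop t b
  drop-++-length []      b t = refl
  drop-++-length (_ ∷ a) b t = drop-++-length a b t

  take-++-length : ∀ (a b : List A) t → take (length a + t) (a ++ b) ≡ a ++ take t b
  take-++-length []      b t = refl
  take-++-length (x ∷ a) b t = cong (x ∷_) (take-++-length a b t)

  drop-++-≤ : ∀ (a b : List A) k → k ≤ length a → drop k (a ++ b) ≡ drop k a ++ b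
  drop-++-≤ a       b zero    _         = refl
  drop-++-≤ (_ ∷ a) b (suc k) (s≤s k≤n) = drop-++-≤ a b k k≤n

  take-++-≤ : ∀ (a b : List A) k → k ≤ length a → take k (a ++ b) ≡ take k a
  take-++-≤ a       b zero    _         = refl
  take-++-≤ (x ∷ a) b (suc k) (s≤s k≤n) = cong (x ∷_) (take-++-≤ a b k k≤n)

  length-rotate : ∀ k (w : List A) → length (drop k w ++ take k w) ≡ length w
  length-rotate k w = begin
    length (drop k w ++ take k w) ≡⟨ length-++-comm (drop k w) (take k w) ⟩
    length (take k w ++ drop k w) ≡⟨ cong length (take++drop≡id k w) ⟩
    length w                      ∎
    where open ≡-Reasoning

  rotate-++-swap : ∀ (a b : List A) k → k ≤ length a →
    drop k (a ++ b) ++ take k (a ++ b) ≡ drop (length b + k) (b ++ a) ++ take (length b + k) (b ++ a)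
  rotate-++-swap a b k k≤n = begin
    drop k (a ++ b) ++ take k (a ++ b)
      ≡⟨ cong₂ _++_ (drop-++-≤ a b k k≤n) (take-++-≤ a b k k≤n) ⟩
    (drop k a ++ b) ++ take k a
      ≡⟨ ++-assoc (drop k a) b (take k a) ⟩
    drop k a ++ (b ++ take k a)
      ≡⟨ sym (cong₂ _++_ (drop-++-length b a k) (take-++-length b a k)) ⟩
    drop (length b + k) (b ++ a) ++ take (length b + k) (b ++ a) ∎
    where open ≡-Reasoning

  rotate-++ : ∀ (a b : List A) k → k < length a + length b →
    Σ ℕ λ k′ → k′ < length a + length b ×
      drop k (b ++ a) ++ take k (b ++ a) ≡ drop k′ (a ++ b) ++ take k′ (a ++ b)
  rotate-++ a b k k<n with length b ≤? k
  ... | no  b≰k = length a + k , +-monoʳ-< (length a) (≰⇒> b≰k) ,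
                  rotate-++-swap b a k (<⇒≤ (≰⇒> b≰k))
  ... | yes b≤k = t , ≤-trans t<a (m≤m+n (length a) (length b)) , eq
    where
    t : ℕ
    t = k ∸ length b
    b+t≡k : length b + t ≡ k
    b+t≡k = m+[n∸m]≡n b≤k
    t<a : t < length a
    t<a = +-cancelʳ-< (length b) t (length a)
      (subst (_< length a + length b) (sym (trans (+-comm t (length b)) b+t≡k)) k<n)
    eq : drop k (b ++ a) ++ take k (b ++ a) ≡ drop t (a ++ b) ++ take t (a ++ b)
    eq = subst (λ k → drop k (b ++ a) ++ take k (b ++ a) ≡ drop t (a ++ b) ++ take t (a ++ b))
           b+t≡k (sym (rotate-++-swap a b t (<⇒≤ t<a)))

  length-take+length-drop : ∀ m (w : List A) → length (take m w) + length (drop m w) ≡ length w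
  length-take+length-drop m w = trans (sym (length-++ (take m w))) (cong length (take++drop≡id m w))

rotate-rotate : ∀ (w : Word) m k → k < length w →
  Σ ℕ λ k′ → k′ < length w × rotate k (rotate m w) ≡ rotate k′ w
rotate-rotate w m k k<n
  with rotate-++ (take m w) (drop m w) k (subst (k <_) (sym (length-take+length-drop m w)) k<n)
... | k′ , k′<n , eq = k′ , subst (k′ <_) (length-take+length-drop m w) k′<n ,
                       trans eq (cong (rotate k′) (take++drop≡id m w))

lyndon-≼-rotate-lyndon : ∀ w k → k < length w → lyndon w ≼ rotate k (lyndon w)
lyndon-≼-rotate-lyndon w k k<n with lyndon-isRotation w (≤-trans (s≤s z≤n) k<n)
... | m , _ , L≡ with rotate-rotate w m k k<n
...   | k′ , k′<n , eq = subst (lyndon w ≼_) (sym (trans (cong (rotate k) L≡) eq))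
                           (lyndon-≼-rotate w k′ k′<n)

length-lyndon : ∀ w → length (lyndon w) ≡ length w
length-lyndon []          = refl
length-lyndon w@(_ ∷ _) with lyndon-isRotation w (s≤s z≤n)
... | m , _ , L≡ = trans (cong length L≡) (length-rotate m w)

length-flip : ∀ i w → length (flip i w) ≡ length w
length-flip _       []      = refl
length-flip zero    (_ ∷ w) = refl
length-flip (suc i) (_ ∷ w) = cong suc (length-flip i w)

at-++ˡ : ∀ u v q → q < length u → at (u ++ v) q ≡ at u q
at-++ˡ (_ ∷ u) v zero    _         = refl
at-++ˡ (_ ∷ u) v (suc q) (s≤s q<n) = at-++ˡ u v q q<n

flip-++ˡ : ∀ u v q → q < length u → flip q (u ++ v) ≡ flip q u ++ v
flip-++ˡ (_ ∷ u) v zero    _         = refl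
flip-++ˡ (b ∷ u) v (suc q) (s≤s q<n) = cong (b ∷_) (flip-++ˡ u v q q<n)

at-drop : ∀ w k i → k ≤ i → at (drop k w) (i ∸ k) ≡ at w i
at-drop w       zero    i       _         = refl
at-drop []      (suc k) i       _         = refl
at-drop (_ ∷ w) (suc k) (suc i) (s≤s k≤i) = at-drop w k i k≤i

flip-drop : ∀ w k i → k ≤ i → flip (i ∸ k) (drop k w) ≡ drop k (flip i w)
flip-drop w       zero    i       _         = refl
flip-drop []      (suc k) i       _         = refl
flip-drop (_ ∷ w) (suc k) (suc i) (s≤s k≤i) = flip-drop w k i k≤i

take-flip : ∀ w k i → k ≤ i → take k (flip i w) ≡ take k w
take-flip w       zero    i       _         = refl
take-flip []      (suc k) i       _         = refl
take-flip (b ∷ w) (suc k) (suc i) (s≤s k≤i) = cong (b ∷_) (take-flip w k i k≤i)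

∸<length-drop : ∀ (w : Word) k i → k ≤ i → i < length w → i ∸ k < length (drop k w)
∸<length-drop w k i k≤i i<n = subst (i ∸ k <_) (sym (length-drop k w)) (∸-monoˡ-< i<n k≤i)

at-rotate : ∀ w k i → k ≤ i → i < length w → at (rotate k w) (i ∸ k) ≡ at w i
at-rotate w k i k≤i i<n =
  trans (at-++ˡ (drop k w) (take k w) (i ∸ k) (∸<length-drop w k i k≤i i<n)) (at-drop w k i k≤i)

flip-rotate : ∀ w k i → k ≤ i → i < length w → flip (i ∸ k) (rotate k w) ≡ rotate k (flip i w)
flip-rotate w k i k≤i i<n =
  trans (flip-++ˡ (drop k w) (take k w) (i ∸ k) (∸<length-drop w k i k≤i i<n))
        (cong₂ _++_ (flip-drop w k i k≤i) (sym (take-flip w k i k≤i)))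

flip-≼-flip : ∀ u v d e → u ≼ v → at v d ≡ true → d < e → flip e u ≼ flip d v
flip-≼-flip []          _           _       _       _  _  _         = refl
flip-≼-flip (_ ∷ u)     []          _       _       () _  _
flip-≼-flip (true ∷ u)  (true ∷ v)  zero    (suc e) _  _  _         = refl
flip-≼-flip (false ∷ u) (true ∷ v)  zero    (suc e) () _  _
flip-≼-flip (_ ∷ u)     (false ∷ v) zero    _       _  () _
flip-≼-flip (true ∷ u)  (true ∷ v)  (suc d) (suc e) h  hv (s≤s d<e) = flip-≼-flip u v d e h hv d<e
flip-≼-flip (false ∷ u) (false ∷ v) (suc d) (suc e) h  hv (s≤s d<e) = flip-≼-flip u v d e h hv d<e
flip-≼-flip (true ∷ u)  (false ∷ v) (suc d) (suc e) _  _  _         = refl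
flip-≼-flip (false ∷ u) (true ∷ v)  (suc d) (suc e) () _  _

flip-≼-rotate-flip : ∀ w i k → i < length w → at w i ≡ true → w ≼ rotate k w →
  0 < k → k ≤ i → flip i w ≼ rotate k (flip i w)
flip-≼-rotate-flip w i k i<n wᵢ≡1 w≼ 0<k k≤i =
  subst (flip i w ≼_) (flip-rotate w k i k≤i i<n)
    (flip-≼-flip w (rotate k w) (i ∸ k) i w≼ (trans (at-rotate w k i k≤i i<n) wᵢ≡1)
       (∸-monoʳ-< 0<k k≤i))

MinimalRotation : Word → Set
MinimalRotation w = ∀ k → k < length w → w ≼ rotate k w

lyndon-minimalRotation : ∀ w → MinimalRotation (lyndon w)
lyndon-minimalRotation w k k<n = lyndon-≼-rotate-lyndon w k (subst (k <_) (length-lyndon w) k<n)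

lyndon-≡-rotate-0 : ∀ u k → lyndon u ≡ rotate k u → u ≼ rotate k u → lyndon u ≡ rotate 0 u
lyndon-≡-rotate-0 u k L≡ u≼ = begin
  lyndon u   ≡⟨ L≡ ⟩
  rotate k u ≡⟨ lexLeq-antisym (rotate k u) u (subst (_≼ u) L≡ (lyndon-≼-self u)) u≼ ⟩
  u          ≡⟨ sym (++-identityʳ u) ⟩
  rotate 0 u ∎
  where open ≡-Reasoning

lyndon-flip-start : ∀ w i → MinimalRotation w → i < length w → at w i ≡ true →
  Σ ℕ λ j → j < length w × lyndon (flip i w) ≡ rotate j (flip i w) × (j ≡ 0 ⊎ i < j)
lyndon-flip-start w i w-min i<n wᵢ≡1 with lyndon-isRotation (flip i w) 0<n′
  where
  0<n′ : 0 < length (flip i w)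
  0<n′ = subst (0 <_) (sym (length-flip i w)) (≤-trans (s≤s z≤n) i<n)
... | zero , _ , L≡ = 0 , ≤-trans (s≤s z≤n) i<n , L≡ , inj₁ refl
... | k@(suc _) , k<n′ , L≡ with i <? k
...   | yes i<k = k , subst (k <_) (length-flip i w) k<n′ , L≡ , inj₂ i<k
...   | no  i≮k = 0 , ≤-trans (s≤s z≤n) i<n ,
  lyndon-≡-rotate-0 (flip i w) k L≡
    (flip-≼-rotate-flip w i k i<n wᵢ≡1 (w-min k (subst (k <_) (length-flip i w) k<n′))
       (s≤s z≤n) (≮⇒≥ i≮k)) ,
  inj₁ refl

mainTheorem7 : (x y : Word) → Phi x y →
    (i : ℕ) → i < length x → at (lyndon x) i ≡ true →
    Rot (flip i (lyndon x)) y →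
    Σ ℕ λ j → j < length x ×
      lyndon (flip i (lyndon x)) ≡ rotate j (flip i (lyndon x)) ×
      (j ≡ 0 ⊎ i < j)
mainTheorem7 x _ _ i i<n xᵢ≡1 _
  with lyndon-flip-start (lyndon x) i (lyndon-minimalRotation x)
         (subst (i <_) (sym (length-lyndon x)) i<n) xᵢ≡1
... | j , j<n , L≡ , j≡0⊎i<j = j , subst (j <_) (length-lyndon x) j<n , L≡ , j≡0⊎i<j
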